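{- Let $p_0\in\{2,4\}$ and $\varepsilon\in[\tfrac12,\tfrac12+\tfrac1{|p_0|})$, and let $k=\lfloor\varepsilon|p_0|\rfloor$. Then $P(x)=x^2+p_1x+p_0$ (with $p_1\in\mathbb{Z}$) is an $\varepsilon$-CNS polynomial if and only if $-p_0+k\le p_1\le k+1$.
   Context: For a monic $P\in\mathbb{Z}[x]$ with $|P(0)|=|p_0|\ge2$ and $\varepsilon\in[0,1)$, put $\mathcal{N}_{\varepsilon}=[-\varepsilon|p_0|,(1-\varepsilon)|p_0|)\cap\mathbb{Z}$. $P$ is an $\varepsilon$-CNS polynomial if for every $a\in\mathbb{Z}[x]$ there exist an integer $l>0$ and $d_0,\dots,d_{l-1}\in\mathcal{N}_\varepsilon$ with $a\equiv\sum_{j=0}^{l-1}d_jx^j\pmod P$.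
   Formalization: The parameter ε ranges over the rationals in $[\tfrac12,\tfrac12+\tfrac1{|p_0|})$, both in the lemma and in the notion of ε-CNS polynomial and its digit set. -}

module Defs where

open import Data.Nat as ℕ using (ℕ; zero; suc)
open import Data.Integer as ℤ using (ℤ; +_; -_; ∣_∣)
open import Data.Rational as ℚ using (ℚ; _/_)
open import Data.List using (List; []; _∷_; map; length)
open import Data.List.Relation.Unary.All using (All)
open import Data.Product using (Σ; ∃; _×_)
open import Relation.Binary.PropositionalEquality using (_≡_)

-- Integer polynomials as coefficient lists, lowest degree first:
-- a₀ ∷ a₁ ∷ … ∷ aₙ ∷ []  represents  a₀ + a₁ x + … + aₙ xⁿ.
Poly : Set
Poly = List ℤ

infixl 6 _⊕_
_⊕_ : Poly → Poly → Poly
[]       ⊕ q        = q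
p        ⊕ []       = p
(a ∷ p)  ⊕ (b ∷ q)  = (a ℤ.+ b) ∷ (p ⊕ q)

neg : Poly → Poly
neg = map -_

infixl 7 _⊛_
_⊛_ : Poly → Poly → Poly
[]      ⊛ q = []
(a ∷ p) ⊛ q = map (a ℤ.*_) q ⊕ (ℤ.0ℤ ∷ (p ⊛ q))

IsZero : Poly → Set
IsZero p = All (_≡ ℤ.0ℤ) p

_≡_[mod_] : Poly → Poly → Poly → Set
a ≡ b [mod P ] = ∃ λ (q : Poly) → IsZero (a ⊕ neg b ⊕ neg (P ⊛ q))

const : Poly → ℤ
const []      = ℤ.0ℤ
const (a ∷ _) = a

toℚ : ℤ → ℚ
toℚ z = z / 1

-- 1/n for n : ℕ (with 1/0 := 0, never used)
recipℕ : ℕ → ℚ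
recipℕ zero    = ℚ.0ℚ
recipℕ (suc n) = + 1 / suc n

InDigits : ℚ → ℤ → ℤ → Set
InDigits ε p₀ d =
  (ℚ.- (ε ℚ.* toℚ (+ ∣ p₀ ∣)) ℚ.≤ toℚ d) ×
  (toℚ d ℚ.< (ℚ.1ℚ ℚ.- ε) ℚ.* toℚ (+ ∣ p₀ ∣))

IsεCNS : ℚ → Poly → Set
IsεCNS ε P = (a : Poly) → ∃ λ (ds : Poly) →
  (0 ℕ.< length ds) × All (InDigits ε (const P)) ds × (a ≡ ds [mod P ])

module Submission where

-- Reducing modulo P = x² + p₁ x + p₀ identifies ℤ[x]/(P) with ℤ² (coefficients of 1 and x), and a
-- representation a ≡ Σ dⱼ xʲ (mod P) unwinds digit by digit: (u , v) is the class of d + x w′ exactly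
-- when d ≡ u (mod p₀) and w′ = step (u , v). For these ε the digit set 𝒩_ε is a window of p₀
-- consecutive integers, so each digit is forced and P is ε-CNS iff every orbit of step reaches (0 , 0).
-- For p₁ in the stated range the norm u² - p₁ u v + p₀ v² shrinks by a factor of about p₀ along orbits
-- until it is small, and the few small points are checked by computation. Otherwise a nonzero
-- step-invariant set keeps orbits away from (0 , 0): a pair of opposite cones for p₁ > p₀, a cone for
-- p₁ < - p₀, and a fixed point or a 2-cycle in the remaining cases.

open import Defs
open import Data.Integer as ℤ using (ℤ; +_; -_; ∣_∣)
open import Data.Rational as ℚ using (ℚ; ½; floor)
open import Data.List using (_∷_; [])
open import Data.Product using (_×_)
open import Data.Sum using (_⊎_)
open import Function.Bundles using (_⇔_)
open import Relation.Binary.PropositionalEquality using (_≡_)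

open import Data.Bool using (Bool; true; false; T)
open import Data.Bool.ListAction using (all)
open import Data.Empty using (⊥; ⊥-elim)
open import Data.Integer using (_+_; _*_; _-_; _≤_; _<_; 0ℤ; 1ℤ; -1ℤ; +≤+; +<+; -≤+; -[1+_])
open import Data.Integer.DivMod using (n%d<d; a≡a%n+[a/n]*n)
open import Data.Integer.Properties
open import Data.Integer.Tactic.RingSolver using (solve-∀)
open import Data.List using (List; map; length)
open import Data.List.Membership.Propositional using (_∈_)
open import Data.List.Relation.Unary.All as All using (All; []; _∷_)
open import Data.List.Relation.Unary.All.Properties using (all⁺)
open import Data.List.Relation.Unary.Any using (here; there)
open import Data.Nat as ℕ using (ℕ; zero; suc)
open import Data.Nat.GCD using (gcd-zeroʳ)
open import Data.Nat.Induction using (<-wellFounded)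
open import Data.Product using (∃; _,_; proj₁; proj₂)
open import Data.Product.Function.NonDependent.Propositional using (_×-⇔_)
open import Data.Product.Properties using (≡-dec)
open import Data.Rational.Properties as ℚP using (↥-/; ↧-/)
open import Data.Sum using (inj₁; inj₂)
open import Function.Base using (_∘_)
open import Function.Bundles using (mk⇔; Equivalence)
open import Function.Construct.Composition using (_⇔-∘_)
open import Induction.WellFounded using (Acc; acc)
open import Relation.Binary.Definitions using (tri<; tri≈; tri>; DecidableEquality)
open import Relation.Binary.PropositionalEquality using (refl; sym; trans; cong; cong₂; subst; subst₂; _≢_; module ≡-Reasoning)
open import Relation.Nullary using (¬_; yes; no)
open import Relation.Nullary.Decidable using (True; toWitness; from-yes)

smaller-quotient⇒< : ∀ {p r r′ q q′} → 0ℤ ≤ r → r < p → 0ℤ ≤ r′ → q < q′ → r + q * p < r′ + q′ * p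
smaller-quotient⇒< {p} {r} {r′} {q} {q′} 0≤r r<p 0≤r′ q<q′ = begin-strict
  r + q * p       <⟨ +-monoˡ-< (q * p) r<p ⟩
  p + q * p       ≡⟨ sym (suc-* q p) ⟩
  ℤ.suc q * p     ≤⟨ *-monoʳ-≤-nonNeg p {{ℤ.nonNegative (<⇒≤ (≤-<-trans 0≤r r<p))}} (i<j⇒suc[i]≤j q<q′) ⟩
  q′ * p          ≤⟨ i≤j+i (q′ * p) r′ {{ℤ.nonNegative 0≤r′}} ⟩
  r′ + q′ * p     ∎
  where open ≤-Reasoning

quotient-unique : ∀ {p r₁ r₂ q₁ q₂} → 0ℤ ≤ r₁ → r₁ < p → 0ℤ ≤ r₂ → r₂ < p →
                  r₁ + q₁ * p ≡ r₂ + q₂ * p → q₁ ≡ q₂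
quotient-unique {q₁ = q₁} {q₂} 0≤r₁ r₁<p 0≤r₂ r₂<p eq with <-cmp q₁ q₂
... | tri< q₁<q₂ _ _ = ⊥-elim (<-irrefl eq (smaller-quotient⇒< 0≤r₁ r₁<p 0≤r₂ q₁<q₂))
... | tri≈ _ q₁≡q₂ _ = q₁≡q₂
... | tri> _ _ q₂<q₁ = ⊥-elim (<-irrefl (sym eq) (smaller-quotient⇒< 0≤r₂ r₂<p 0≤r₁ q₂<q₁))

0<j-i⇒i<j : ∀ {i j} → 0ℤ < j - i → i < j
0<j-i⇒i<j {i} {j} h = subst₂ _<_ (+-identityʳ i) (e i j) (+-monoʳ-< i h)
  where
  e : ∀ i j → i + (j - i) ≡ j
  e = solve-∀

i<j⇒0<j-i : ∀ {i j} → i < j → 0ℤ < j - i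
i<j⇒0<j-i {i} {j} h = subst (_< j - i) (+-inverseʳ i) (+-monoˡ-< (- i) h)

nonNeg-* : ∀ {a b} → 0ℤ ≤ a → 0ℤ ≤ b → 0ℤ ≤ a * b
nonNeg-* {a} 0≤a 0≤b = subst (_≤ a * _) (*-zeroʳ a) (*-monoˡ-≤-nonNeg a {{ℤ.nonNegative 0≤a}} 0≤b)

square-nonNeg : ∀ i → 0ℤ ≤ i * i
square-nonNeg (+ n)      = nonNeg-* {+ n} {+ n} (+≤+ ℕ.z≤n) (+≤+ ℕ.z≤n)
square-nonNeg -[1+ n ]   = +≤+ ℕ.z≤n

square-mono : ∀ {a b} → 0ℤ ≤ a → a ≤ b → a * a ≤ b * b
square-mono {a} {b} 0≤a a≤b = begin
  a * a   ≤⟨ *-monoˡ-≤-nonNeg a {{ℤ.nonNegative 0≤a}} a≤b ⟩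
  a * b   ≤⟨ *-monoʳ-≤-nonNeg b {{ℤ.nonNegative (≤-trans 0≤a a≤b)}} a≤b ⟩
  b * b   ∎
  where open ≤-Reasoning

square<⇒bounded : ∀ {i m} → 0ℤ ≤ m → i * i < m * m → - m < i × i < m
square<⇒bounded {i} {m} 0≤m i²<m² = ≰⇒> below , ≰⇒> above
  where
  e : ∀ i → - i * - i ≡ i * i
  e = solve-∀
  above : ¬ m ≤ i
  above m≤i = <⇒≱ i²<m² (square-mono 0≤m m≤i)
  below : ¬ i ≤ - m
  below i≤-m = <⇒≱ i²<m² (subst (m * m ≤_) (e i) (square-mono 0≤m (subst (_≤ - i) (neg-involutive m) (neg-mono-≤ i≤-m))))

-- 8 (m N - (N - d s + d²)) = 4 ((2m - 3) N - 6 d²) + (4 N - s²) + (s + 4 d)² is positive.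
contraction-bound : ∀ m N s d → s * s ≤ + 4 * N → + 6 * (d * d) < (+ 2 * m - + 3) * N →
                    N - d * s + d * d < m * N
contraction-bound m N s d s²≤4N 6d²<[2m-3]N = 0<j-i⇒i<j (*-cancelˡ-<-nonNeg (+ 8) (begin-strict
  0ℤ                                                     <⟨ *-monoˡ-<-pos (+ 4) (i<j⇒0<j-i 6d²<[2m-3]N) ⟩
  + 4 * A                                                ≤⟨ i≤i+j (+ 4 * A) _ {{ℤ.nonNegative 0≤rest}} ⟩
  + 4 * A + ((+ 4 * N - s * s) + (s + + 4 * d) * (s + + 4 * d)) ≡⟨ e m N s d ⟩
  + 8 * (m * N - (N - d * s + d * d))                    ∎))
  where
  open ≤-Reasoning
  A = (+ 2 * m - + 3) * N - + 6 * (d * d)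
  0≤rest : 0ℤ ≤ (+ 4 * N - s * s) + (s + + 4 * d) * (s + + 4 * d)
  0≤rest = +-mono-≤ (i≤j⇒0≤j-i s²≤4N) (square-nonNeg (s + + 4 * d))
  e : ∀ m N s d → + 4 * ((+ 2 * m - + 3) * N - + 6 * (d * d)) + ((+ 4 * N - s * s) + (s + + 4 * d) * (s + + 4 * d))
                  ≡ + 8 * (m * N - (N - d * s + d * d))
  e = solve-∀

interval : ℤ → ℕ → List ℤ
interval lo zero    = []
interval lo (suc n) = lo ∷ interval (ℤ.suc lo) n

∈-interval : ∀ {lo x} n → lo ≤ x → x < lo + + n → x ∈ interval lo n
∈-interval {lo} {x} zero    lo≤x x<lo+0 = ⊥-elim (<⇒≱ (subst (x <_) (+-identityʳ lo) x<lo+0) lo≤x)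
∈-interval {lo} {x} (suc n) lo≤x x<lo+n+1 with lo ℤ.≟ x
... | yes refl = here refl
... | no lo≢x  = there (∈-interval n (i<j⇒suc[i]≤j (≤∧≢⇒< lo≤x lo≢x)) (subst (x <_) (e lo (+ n)) x<lo+n+1))
  where
  e : ∀ a b → a + (1ℤ + b) ≡ 1ℤ + a + b
  e = solve-∀

-- Polynomials modulo P

coef : Poly → ℕ → ℤ
coef []      _       = 0ℤ
coef (a ∷ _) zero    = a
coef (_ ∷ p) (suc n) = coef p n

coef-⊕ : ∀ p q n → coef (p ⊕ q) n ≡ coef p n + coef q n
coef-⊕ []      q       n       = sym (+-identityˡ _)
coef-⊕ (a ∷ p) []      n       = sym (+-identityʳ _)
coef-⊕ (a ∷ p) (b ∷ q) zero    = refl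
coef-⊕ (a ∷ p) (b ∷ q) (suc n) = coef-⊕ p q n

coef-neg : ∀ p n → coef (neg p) n ≡ - coef p n
coef-neg []      n       = refl
coef-neg (a ∷ p) zero    = refl
coef-neg (a ∷ p) (suc n) = coef-neg p n

coef-⊖ : ∀ p q n → coef (p ⊕ neg q) n ≡ coef p n - coef q n
coef-⊖ p q n = trans (coef-⊕ p (neg q) n) (cong (_+_ (coef p n)) (coef-neg q n))

coef-⊛-∷ : ∀ p t q n → coef (p ⊛ (t ∷ q)) n ≡ coef (0ℤ ∷ p ⊛ q) n + coef p n * t
coef-⊛-∷ []      t q zero    = sym (*-zeroˡ t)
coef-⊛-∷ []      t q (suc n) = sym (*-zeroˡ t)
coef-⊛-∷ (a ∷ p) t q zero    = trans (+-identityʳ (a * t)) (sym (+-identityˡ _))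
coef-⊛-∷ (a ∷ p) t q (suc n) = begin
  coef (map (a *_) q ⊕ p ⊛ (t ∷ q)) n                             ≡⟨ coef-⊕ (map (a *_) q) _ n ⟩
  coef (map (a *_) q) n + coef (p ⊛ (t ∷ q)) n                    ≡⟨ cong (_+_ (coef (map (a *_) q) n)) (coef-⊛-∷ p t q n) ⟩
  coef (map (a *_) q) n + (coef (0ℤ ∷ p ⊛ q) n + coef p n * t)    ≡⟨ sym (+-assoc (coef (map (a *_) q) n) _ _) ⟩
  coef (map (a *_) q) n + coef (0ℤ ∷ p ⊛ q) n + coef p n * t      ≡⟨ cong (_+ coef p n * t) (sym (coef-⊕ (map (a *_) q) _ n)) ⟩
  coef (map (a *_) q ⊕ (0ℤ ∷ p ⊛ q)) n + coef p n * t             ∎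
  where open ≡-Reasoning

coef≡0⇒IsZero : ∀ {p} → (∀ n → coef p n ≡ 0ℤ) → IsZero p
coef≡0⇒IsZero {[]}    _ = []
coef≡0⇒IsZero {a ∷ p} h = h zero ∷ coef≡0⇒IsZero (λ n → h (suc n))

infixl 6 _⊞_
_⊞_ : ℤ × ℤ → ℤ × ℤ → ℤ × ℤ
(a , b) ⊞ (c , d) = a + c , b + d

⊟_ : ℤ × ℤ → ℤ × ℤ
⊟ (a , b) = - a , - b

infixl 7 _⊡_
_⊡_ : ℤ → ℤ × ℤ → ℤ × ℤ
c ⊡ (a , b) = c * a , c * b

⊞-⊟≡0⇒≡ : ∀ x y → x ⊞ ⊟ y ≡ (0ℤ , 0ℤ) → x ≡ y
⊞-⊟≡0⇒≡ (a , b) (c , d) eq = cong₂ _,_ (i-j≡0⇒i≡j a c (cong proj₁ eq)) (i-j≡0⇒i≡j b d (cong proj₂ eq))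

_≟²_ : DecidableEquality (ℤ × ℤ)
_≟²_ = ≡-dec ℤ._≟_ ℤ._≟_

toPoly : ℤ × ℤ → Poly
toPoly (u , v) = u ∷ v ∷ []

module Residue (p₀ p₁ : ℤ) where

  P : Poly
  P = p₀ ∷ p₁ ∷ + 1 ∷ []

  -- If r is the class of a polynomial f modulo P in the basis 1, x, then push d r is the class of d + x f.
  push : ℤ → ℤ × ℤ → ℤ × ℤ
  push d (u , v) = d - p₀ * v , u - p₁ * v

  residue : Poly → ℤ × ℤ
  residue []      = 0ℤ , 0ℤ
  residue (a ∷ p) = push a (residue p)

  residue-toPoly : ∀ w → residue (toPoly w) ≡ w
  residue-toPoly (u , v) = cong₂ _,_ (e₁ u p₀ p₁) (e₂ v p₀ p₁)
    where
    e₁ : ∀ u p q → u - p * (0ℤ - q * 0ℤ) ≡ u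
    e₁ = solve-∀
    e₂ : ∀ v p q → v - p * 0ℤ - q * (0ℤ - q * 0ℤ) ≡ v
    e₂ = solve-∀

  residue-⊕ : ∀ p q → residue (p ⊕ q) ≡ residue p ⊞ residue q
  residue-⊕ []      q       = sym (cong₂ _,_ (+-identityˡ _) (+-identityˡ _))
  residue-⊕ (a ∷ p) []      = sym (cong₂ _,_ (+-identityʳ _) (+-identityʳ _))
  residue-⊕ (a ∷ p) (b ∷ q) = trans (cong (push (a + b)) (residue-⊕ p q)) (push-⊞ (residue p) (residue q))
    where
    e : ∀ a b p x y → a + b - p * (x + y) ≡ a - p * x + (b - p * y)
    e = solve-∀
    push-⊞ : ∀ x y → push (a + b) (x ⊞ y) ≡ push a x ⊞ push b y
    push-⊞ (x₁ , x₂) (y₁ , y₂) = cong₂ _,_ (e a b p₀ x₂ y₂) (e x₁ y₁ p₁ x₂ y₂)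

  residue-neg : ∀ p → residue (neg p) ≡ ⊟ residue p
  residue-neg []      = refl
  residue-neg (a ∷ p) = trans (cong (push (- a)) (residue-neg p)) (push-⊟ (residue p))
    where
    e : ∀ a p x → - a - p * - x ≡ - (a - p * x)
    e = solve-∀
    push-⊟ : ∀ x → push (- a) (⊟ x) ≡ ⊟ push a x
    push-⊟ (x₁ , x₂) = cong₂ _,_ (e a p₀ x₂) (e x₁ p₁ x₂)

  residue-scale : ∀ c p → residue (map (c *_) p) ≡ c ⊡ residue p
  residue-scale c []      = sym (cong₂ _,_ (*-zeroʳ c) (*-zeroʳ c))
  residue-scale c (a ∷ p) = trans (cong (push (c * a)) (residue-scale c p)) (push-⊡ (residue p))
    where
    e : ∀ c a p x → c * a - p * (c * x) ≡ c * (a - p * x)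
    e = solve-∀
    push-⊡ : ∀ x → push (c * a) (c ⊡ x) ≡ c ⊡ push a x
    push-⊡ (x₁ , x₂) = cong₂ _,_ (e c a p₀ x₂) (e c x₁ p₁ x₂)

  residue-IsZero : ∀ {p} → IsZero p → residue p ≡ (0ℤ , 0ℤ)
  residue-IsZero []         = refl
  residue-IsZero (refl ∷ z) rewrite residue-IsZero z = cong₂ _,_ (e p₀) (e p₁)
    where
    e : ∀ p → 0ℤ - p * 0ℤ ≡ 0ℤ
    e = solve-∀

  residue-P⊛ : ∀ q → residue (P ⊛ q) ≡ (0ℤ , 0ℤ)
  residue-P⊛ q
    rewrite residue-⊕ (map (p₀ *_) q) (0ℤ ∷ (p₁ ∷ + 1 ∷ []) ⊛ q)
          | residue-⊕ (map (p₁ *_) q) (0ℤ ∷ (+ 1 ∷ []) ⊛ q)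
          | residue-⊕ (map (+ 1 *_) q) (0ℤ ∷ [])
          | residue-scale p₀ q | residue-scale p₁ q | residue-scale (+ 1) q
    = P-vanishes (residue q)
    where
    e₁ : ∀ p₀ p₁ u v →
         p₀ * u + (0ℤ - p₀ * (p₁ * v + (+ 1 * u + (0ℤ - p₀ * 0ℤ) - p₁ * (+ 1 * v + (0ℤ - p₁ * 0ℤ))))) ≡ 0ℤ
    e₁ = solve-∀
    e₂ : ∀ p₀ p₁ u v →
         p₀ * v + (p₁ * u + (0ℤ - p₀ * (+ 1 * v + (0ℤ - p₁ * 0ℤ)))
                   - p₁ * (p₁ * v + (+ 1 * u + (0ℤ - p₀ * 0ℤ) - p₁ * (+ 1 * v + (0ℤ - p₁ * 0ℤ))))) ≡ 0ℤ
    e₂ = solve-∀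
    P-vanishes : ∀ r → p₀ ⊡ r ⊞ push 0ℤ (p₁ ⊡ r ⊞ push 0ℤ (+ 1 ⊡ r ⊞ push 0ℤ (0ℤ , 0ℤ))) ≡ (0ℤ , 0ℤ)
    P-vanishes (u , v) = cong₂ _,_ (e₁ p₀ p₁ u v) (e₂ p₀ p₁ u v)

  residue-⊖ : ∀ p q → residue (p ⊕ neg q) ≡ residue p ⊞ ⊟ residue q
  residue-⊖ p q = trans (residue-⊕ p (neg q)) (cong (residue p ⊞_) (residue-neg q))

  residue-⊖-P⊛ : ∀ p q → residue (p ⊕ neg (P ⊛ q)) ≡ residue p
  residue-⊖-P⊛ p q rewrite residue-⊖ p (P ⊛ q) | residue-P⊛ q =
    cong₂ _,_ (+-identityʳ _) (+-identityʳ _)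

  residue-is-remainder : ∀ a → ∃ λ q → ∀ n → coef (a ⊕ neg (P ⊛ q)) n ≡ coef (toPoly (residue a)) n
  residue-is-remainder []      = [] , λ { 0 → refl ; 1 → refl ; 2 → refl ; (suc (suc (suc _))) → refl }
  residue-is-remainder (c ∷ a) = let (q , h) = residue-is-remainder a in proj₂ (residue a) ∷ q , remainder-step {q} h
    where
    x-shift : ∀ u v n → coef (u ∷ v ∷ []) n - coef (p₁ ∷ + 1 ∷ []) n * v ≡ coef (u - p₁ * v ∷ []) n
    x-shift u v zero          = refl
    x-shift u v (suc zero)    = e v
      where
      e : ∀ v → v - + 1 * v ≡ 0ℤ
      e = solve-∀
    x-shift u v (suc (suc n)) = e v
      where
      e : ∀ v → 0ℤ - 0ℤ * v ≡ 0ℤ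
      e = solve-∀

    remainder-step : ∀ {q} → (∀ n → coef (a ⊕ neg (P ⊛ q)) n ≡ coef (toPoly (residue a)) n)
                  → ∀ n → coef ((c ∷ a) ⊕ neg (P ⊛ (proj₂ (residue a) ∷ q))) n ≡ coef (toPoly (residue (c ∷ a))) n
    remainder-step {q} h zero = begin
      coef ((c ∷ a) ⊕ neg (P ⊛ (v ∷ q))) 0  ≡⟨ coef-⊖ (c ∷ a) (P ⊛ (v ∷ q)) 0 ⟩
      c - coef (P ⊛ (v ∷ q)) 0             ≡⟨ cong (λ x → c - x) (trans (coef-⊛-∷ P v q 0) (+-identityˡ _)) ⟩
      c - p₀ * v                           ∎
      where open ≡-Reasoning; v = proj₂ (residue a)
    remainder-step {q} h (suc n) = begin
      coef ((c ∷ a) ⊕ neg (P ⊛ (v ∷ q))) (suc n)                        ≡⟨ coef-⊖ (c ∷ a) (P ⊛ (v ∷ q)) (suc n) ⟩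
      coef a n - coef (P ⊛ (v ∷ q)) (suc n)                            ≡⟨ cong (λ x → coef a n - x) (coef-⊛-∷ P v q (suc n)) ⟩
      coef a n - (coef (P ⊛ q) n + coef (p₁ ∷ + 1 ∷ []) n * v)         ≡⟨ e (coef a n) (coef (P ⊛ q) n) _ ⟩
      coef a n - coef (P ⊛ q) n - coef (p₁ ∷ + 1 ∷ []) n * v           ≡⟨ cong (_- coef (p₁ ∷ + 1 ∷ []) n * v) a-Pq ⟩
      coef (toPoly (residue a)) n - coef (p₁ ∷ + 1 ∷ []) n * v         ≡⟨ x-shift (proj₁ (residue a)) v n ⟩
      coef (toPoly (residue (c ∷ a))) (suc n)                          ∎
      where
      open ≡-Reasoning
      v = proj₂ (residue a)
      a-Pq : coef a n - coef (P ⊛ q) n ≡ coef (toPoly (residue a)) n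
      a-Pq = trans (sym (coef-⊖ a (P ⊛ q) n)) (h n)
      e : ∀ x y z → x - (y + z) ≡ x - y - z
      e = solve-∀

  ≡[mod]⇔residue≡ : ∀ {a b} → a ≡ b [mod P ] ⇔ residue a ≡ residue b
  ≡[mod]⇔residue≡ {a} {b} = mk⇔ to from
    where
    to : a ≡ b [mod P ] → residue a ≡ residue b
    to (q , z) = ⊞-⊟≡0⇒≡ (residue a) (residue b) (begin
      residue a ⊞ ⊟ residue b                 ≡⟨ sym (residue-⊖ a b) ⟩
      residue (a ⊕ neg b)                     ≡⟨ sym (residue-⊖-P⊛ (a ⊕ neg b) q) ⟩
      residue (a ⊕ neg b ⊕ neg (P ⊛ q))       ≡⟨ residue-IsZero z ⟩
      (0ℤ , 0ℤ)                               ∎)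
      where open ≡-Reasoning

    from : residue a ≡ residue b → a ≡ b [mod P ]
    from eq = q , coef≡0⇒IsZero (λ n → trans (h n) (trans (cong (λ r → coef (toPoly r) n) no-residue) (zero-coefs n)))
      where
      zero-coefs : ∀ n → coef (toPoly (0ℤ , 0ℤ)) n ≡ 0ℤ
      zero-coefs zero          = refl
      zero-coefs (suc zero)    = refl
      zero-coefs (suc (suc n)) = refl
      q = proj₁ (residue-is-remainder (a ⊕ neg b))
      h = proj₂ (residue-is-remainder (a ⊕ neg b))
      no-residue : residue (a ⊕ neg b) ≡ (0ℤ , 0ℤ)
      no-residue = trans (residue-⊖ a b) (trans (cong (λ r → r ⊞ ⊟ residue b) eq)
                     (cong₂ _,_ (+-inverseʳ (proj₁ (residue b))) (+-inverseʳ (proj₂ (residue b)))))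

-- Digit expansions

module Dynamics (p₀ p₁ lo : ℤ) .{{_ : ℤ.Positive p₀}} where

  open Residue p₀ p₁ public

  private instance
    p₀≢0 : ℤ.NonZero p₀
    p₀≢0 = ℤ.>-nonZero (positive⁻¹ p₀)
    p₀≥0 : ℤ.NonNegative p₀
    p₀≥0 = ℤ.nonNegative (<⇒≤ (positive⁻¹ p₀))

  InWindow : ℤ → Set
  InWindow d = lo ≤ d × d < lo + p₀

  quot : ℤ → ℤ
  quot u = (u - lo) ℤ./ p₀

  digit : ℤ → ℤ
  digit u = lo + + ((u - lo) ℤ.% p₀)

  remainder<p₀ : ∀ x → + (x ℤ.% p₀) < p₀
  remainder<p₀ x = subst (+ (x ℤ.% p₀) <_) (0≤i⇒+∣i∣≡i (<⇒≤ (positive⁻¹ p₀))) (+<+ (n%d<d x p₀))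

  digit-window : ∀ u → InWindow (digit u)
  digit-window u = i≤i+j lo (+ _) , +-monoʳ-< lo (remainder<p₀ (u - lo))

  digit+quot : ∀ u → digit u + p₀ * quot u ≡ u
  digit+quot u = begin
    lo + + r + p₀ * quot u     ≡⟨ e lo (+ r) p₀ (quot u) ⟩
    lo + (+ r + quot u * p₀)   ≡⟨ cong (_+_ lo) (sym (a≡a%n+[a/n]*n (u - lo) p₀)) ⟩
    lo + (u - lo)              ≡⟨ e′ lo u ⟩
    u                          ∎
    where
    open ≡-Reasoning
    r = (u - lo) ℤ.% p₀
    e : ∀ l r p q → l + r + p * q ≡ l + (r + q * p)
    e = solve-∀
    e′ : ∀ l u → l + (u - l) ≡ u
    e′ = solve-∀

  quot-unique : ∀ {d t u} → InWindow d → d + p₀ * t ≡ u → t ≡ quot u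
  quot-unique {d} {t} {u} (lo≤d , d<lo+p₀) eq = quotient-unique
    (i≤j⇒0≤j-i lo≤d) d-lo<p₀ (+≤+ ℕ.z≤n) (remainder<p₀ (u - lo)) (begin
      d - lo + t * p₀        ≡⟨ e d lo t p₀ ⟩
      d + p₀ * t - lo        ≡⟨ cong (_- lo) eq ⟩
      u - lo                 ≡⟨ a≡a%n+[a/n]*n (u - lo) p₀ ⟩
      + ((u - lo) ℤ.% p₀) + quot u * p₀ ∎)
    where
    open ≡-Reasoning
    e : ∀ d l t p → d - l + t * p ≡ d + p * t - l
    e = solve-∀
    e′ : ∀ l p → l + p - l ≡ p
    e′ = solve-∀
    d-lo<p₀ : d - lo < p₀
    d-lo<p₀ = subst (d - lo <_) (e′ lo p₀) (+-monoˡ-< (- lo) d<lo+p₀)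

  step : ℤ × ℤ → ℤ × ℤ
  step (u , v) = v - p₁ * quot u , - quot u

  push-digit-step : ∀ w → push (digit (proj₁ w)) (step w) ≡ w
  push-digit-step (u , v) = cong₂ _,_ (trans (e₁ (digit u) p₀ (quot u)) (digit+quot u)) (e₂ v p₁ (quot u))
    where
    e₁ : ∀ d p q → d - p * - q ≡ d + p * q
    e₁ = solve-∀
    e₂ : ∀ v p q → v - p * q - p * - q ≡ v
    e₂ = solve-∀

  push-unique : ∀ {d w′ w} → InWindow d → push d w′ ≡ w → w′ ≡ step w
  push-unique {d} {u′ , v′} {u , v} d-ok eq = cong₂ _,_ u′≡ v′≡
    where
    e₁ : ∀ d p v → d - p * v ≡ d + p * - v
    e₁ = solve-∀
    e₂ : ∀ u p v → u ≡ u - p * v + p * v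
    e₂ = solve-∀
    -v′≡quot : - v′ ≡ quot u
    -v′≡quot = quot-unique d-ok (trans (sym (e₁ d p₀ v′)) (cong proj₁ eq))
    v′≡ : v′ ≡ - quot u
    v′≡ = trans (sym (neg-involutive v′)) (cong -_ -v′≡quot)
    u′≡ : u′ ≡ v - p₁ * quot u
    u′≡ = begin
      u′                        ≡⟨ e₂ u′ p₁ v′ ⟩
      u′ - p₁ * v′ + p₁ * v′    ≡⟨ cong₂ (λ a b → a + p₁ * b) (cong proj₂ eq) v′≡ ⟩
      v + p₁ * - quot u         ≡⟨ cong (_+_ v) (sym (neg-distribʳ-* p₁ (quot u))) ⟩
      v - p₁ * quot u           ∎
      where open ≡-Reasoning

  Expansion : ℤ × ℤ → Set
  Expansion w = ∃ λ ds → 0 ℕ.< length ds × All InWindow ds × residue ds ≡ w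

  expansion-step : ∀ w → Expansion (step w) → Expansion w
  expansion-step w (ds , _ , ds-ok , eq) =
    digit (proj₁ w) ∷ ds , ℕ.s≤s ℕ.z≤n , digit-window (proj₁ w) ∷ ds-ok ,
    trans (cong (push (digit (proj₁ w))) eq) (push-digit-step w)

  Invariant : (ℤ × ℤ → Set) → Set
  Invariant S = ∀ w → S w → S (step w)

  -- By push-unique, the tail of an expansion of w is an expansion of step w.
  invariant-no-expansion : ∀ {S} → Invariant S → ¬ S (0ℤ , 0ℤ) → ∀ {w} → S w → ¬ Expansion w
  invariant-no-expansion {S} inv S∌0 {w} w∈S (ds , _ , ds-ok , eq) = go ds ds-ok eq w∈S
    where
    go : ∀ ds {w} → All InWindow ds → residue ds ≡ w → S w → ⊥
    go []       []             refl s = S∌0 s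
    go (d ∷ ds) (d-ok ∷ ds-ok) eq   s = go ds ds-ok (push-unique d-ok eq) (inv _ s)

  2-cycle-no-expansion : ∀ {w₀ w₁} → step w₀ ≡ w₁ → step w₁ ≡ w₀ →
                         w₀ ≢ (0ℤ , 0ℤ) → w₁ ≢ (0ℤ , 0ℤ) → ¬ Expansion w₀
  2-cycle-no-expansion {w₀} {w₁} w₀↦w₁ w₁↦w₀ w₀≢0 w₁≢0 =
    invariant-no-expansion inv (λ { (inj₁ 0≡w₀) → w₀≢0 (sym 0≡w₀) ; (inj₂ 0≡w₁) → w₁≢0 (sym 0≡w₁) }) (inj₁ refl)
    where
    inv : Invariant (λ w → w ≡ w₀ ⊎ w ≡ w₁)
    inv _ (inj₁ refl) = inj₂ w₀↦w₁
    inv _ (inj₂ refl) = inj₁ w₁↦w₀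

  expansion-of-0 : InWindow 0ℤ → Expansion (0ℤ , 0ℤ)
  expansion-of-0 0-ok = 0ℤ ∷ [] , ℕ.s≤s ℕ.z≤n , 0-ok ∷ [] , cong₂ _,_ (e p₀) (e p₁)
    where
    e : ∀ p → 0ℤ - p * 0ℤ ≡ 0ℤ
    e = solve-∀

  reaches-0 : ℕ → ℤ × ℤ → Bool
  reaches-0 zero    w = false
  reaches-0 (suc n) w with w ≟² (0ℤ , 0ℤ)
  ... | yes _ = true
  ... | no  _ = reaches-0 n (step w)

  reaches-0⇒expansion : InWindow 0ℤ → ∀ n w → T (reaches-0 n w) → Expansion w
  reaches-0⇒expansion 0-ok (suc n) w h with w ≟² (0ℤ , 0ℤ)
  ... | yes refl = expansion-of-0 0-ok
  ... | no  _    = expansion-step w (reaches-0⇒expansion 0-ok n (step w) h)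

  quot-lower-bound : lo ≤ 0ℤ → ∀ {x u} → p₀ * x ≤ u → x ≤ quot u
  quot-lower-bound lo≤0 {x} {u} p₀x≤u = subst (x ≤_) (pred-suc (quot u)) (i<j⇒i≤pred[j] (*-cancelˡ-<-nonNeg p₀ (begin-strict
    p₀ * x                    ≤⟨ p₀x≤u ⟩
    u                         ≡⟨ sym (digit+quot u) ⟩
    digit u + p₀ * quot u     <⟨ +-monoˡ-< (p₀ * quot u) digit<p₀ ⟩
    p₀ + p₀ * quot u          ≡⟨ sym (*-suc p₀ (quot u)) ⟩
    p₀ * ℤ.suc (quot u)       ∎)))
    where
    open ≤-Reasoning
    digit<p₀ : digit u < p₀
    digit<p₀ = <-≤-trans (proj₂ (digit-window u)) (subst (lo + p₀ ≤_) (+-identityˡ p₀) (+-monoˡ-≤ p₀ lo≤0))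

  quot-upper-bound : 1ℤ - p₀ ≤ lo → ∀ {x u} → u ≤ p₀ * x → quot u ≤ x
  quot-upper-bound 1-p₀≤lo {x} {u} u≤p₀x = subst (quot u ≤_) (pred-suc x) (i<j⇒i≤pred[j] (*-cancelˡ-<-nonNeg p₀ (begin-strict
    p₀ * quot u               ≡⟨ e (digit u) (p₀ * quot u) ⟩
    digit u + p₀ * quot u - digit u ≡⟨ cong (_- digit u) (digit+quot u) ⟩
    u - digit u               ≤⟨ +-monoˡ-≤ (- digit u) u≤p₀x ⟩
    p₀ * x - digit u          <⟨ +-monoʳ-< (p₀ * x) -digit<p₀ ⟩
    p₀ * x + p₀               ≡⟨ +-comm (p₀ * x) p₀ ⟩
    p₀ + p₀ * x               ≡⟨ sym (*-suc p₀ x) ⟩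
    p₀ * ℤ.suc x              ∎)))
    where
    open ≤-Reasoning
    e : ∀ d a → a ≡ d + a - d
    e = solve-∀
    e′ : ∀ p → - (1ℤ - p) ≡ -1ℤ + p
    e′ = solve-∀
    -digit<p₀ : - digit u < p₀
    -digit<p₀ = i≤pred[j]⇒i<j (subst (- digit u ≤_) (e′ p₀) (neg-mono-≤ (≤-trans 1-p₀≤lo (proj₁ (digit-window u)))))

  module _ (p₀+1≤p₁ : p₀ + 1ℤ ≤ p₁) (1-p₀≤lo : 1ℤ - p₀ ≤ lo) (lo≤0 : lo ≤ 0ℤ) where

    OppositeCones : ℤ × ℤ → Set
    OppositeCones (u , v) = (1ℤ ≤ v × p₀ * v ≤ u) ⊎ (v ≤ -1ℤ × u ≤ p₀ * v)

    opposite-cones-invariant : Invariant OppositeCones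
    opposite-cones-invariant (u , v) (inj₁ (1≤v , p₀v≤u)) = inj₂ (neg-mono-≤ 1≤q , (begin
      v - p₁ * q                        ≤⟨ +-monoˡ-≤ (- (p₁ * q)) v≤q ⟩
      q - p₁ * q                        ≡⟨ e p₀ p₁ q ⟩
      p₀ * - q - (p₁ - (p₀ + 1ℤ)) * q   ≤⟨ i-j≤i (p₀ * - q) _ {{ℤ.nonNegative 0≤[p₁-p₀-1]q}} ⟩
      p₀ * - q                          ∎))
      where
      open ≤-Reasoning
      q = quot u
      v≤q = quot-lower-bound lo≤0 p₀v≤u
      1≤q = ≤-trans 1≤v v≤q
      0≤[p₁-p₀-1]q = nonNeg-* (i≤j⇒0≤j-i p₀+1≤p₁) (≤-trans (+≤+ ℕ.z≤n) 1≤q)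
      e : ∀ p₀ p₁ q → q - p₁ * q ≡ p₀ * - q - (p₁ - (p₀ + 1ℤ)) * q
      e = solve-∀
    opposite-cones-invariant (u , v) (inj₂ (v≤-1 , u≤p₀v)) = inj₁ (neg-mono-≤ q≤-1 , (begin
      p₀ * - q                                ≤⟨ i≤i+j (p₀ * - q) _ {{ℤ.nonNegative 0≤[p₁-p₀-1][-q]}} ⟩
      p₀ * - q + (p₁ - (p₀ + 1ℤ)) * - q  ≡⟨ e p₀ p₁ q ⟩
      q - p₁ * q                              ≤⟨ +-monoˡ-≤ (- (p₁ * q)) q≤v ⟩
      v - p₁ * q                              ∎))
      where
      open ≤-Reasoning
      q = quot u
      q≤v = quot-upper-bound 1-p₀≤lo u≤p₀v
      q≤-1 = ≤-trans q≤v v≤-1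
      0≤[p₁-p₀-1][-q] = nonNeg-* (i≤j⇒0≤j-i p₀+1≤p₁) (neg-mono-≤ (≤-trans q≤-1 (-≤+ {n = 0})))
      e : ∀ p₀ p₁ q → p₀ * - q + (p₁ - (p₀ + 1ℤ)) * - q ≡ q - p₁ * q
      e = solve-∀

    opposite-cones-0 : ¬ OppositeCones (0ℤ , 0ℤ)
    opposite-cones-0 (inj₁ (+≤+ () , _))
    opposite-cones-0 (inj₂ (() , _))

  module _ (p₁≤-[p₀+1] : p₁ ≤ - (p₀ + 1ℤ)) (lo≤0 : lo ≤ 0ℤ) where

    LowerCone : ℤ × ℤ → Set
    LowerCone (u , v) = v ≤ -1ℤ × p₀ * - v ≤ u

    lower-cone-invariant : Invariant LowerCone
    lower-cone-invariant (u , v) (v≤-1 , p₀[-v]≤u) =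
      neg-mono-≤ 1≤q , subst (_≤ v - p₁ * q) (cong (p₀ *_) (sym (neg-involutive q))) (begin
      p₀ * q                                 ≤⟨ i≤i+j (p₀ * q) _ {{ℤ.nonNegative 0≤[-p₀-1-p₁]q}} ⟩
      p₀ * q + (- (p₀ + 1ℤ) - p₁) * q        ≡⟨ e p₀ p₁ q ⟩
      - q - p₁ * q                           ≤⟨ +-monoˡ-≤ (- (p₁ * q)) -q≤v ⟩
      v - p₁ * q                             ∎)
      where
      open ≤-Reasoning
      q = quot u
      -v≤q = quot-lower-bound lo≤0 p₀[-v]≤u
      1≤q = ≤-trans (neg-mono-≤ v≤-1) -v≤q
      -q≤v = subst (- q ≤_) (neg-involutive v) (neg-mono-≤ -v≤q)
      0≤[-p₀-1-p₁]q = nonNeg-* (i≤j⇒0≤j-i p₁≤-[p₀+1]) (≤-trans (+≤+ ℕ.z≤n) 1≤q)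
      e : ∀ p₀ p₁ q → p₀ * q + (- (p₀ + 1ℤ) - p₁) * q ≡ - q - p₁ * q
      e = solve-∀

    lower-cone-0 : ¬ LowerCone (0ℤ , 0ℤ)
    lower-cone-0 (() , _)

  -- norm (u , v) is the field norm of u + v α for a root α of P, and δ = 4 p₀ - p₁² is minus its discriminant.
  norm : ℤ × ℤ → ℤ
  norm (u , v) = u * u - p₁ * u * v + p₀ * (v * v)

  δ : ℤ
  δ = + 4 * p₀ - p₁ * p₁

  four-norm : ∀ u v → + 4 * norm (u , v) ≡ (+ 2 * u - p₁ * v) * (+ 2 * u - p₁ * v) + δ * (v * v)
  four-norm u v = e p₀ p₁ u v
    where
    e : ∀ p₀ p₁ u v → + 4 * (u * u - p₁ * u * v + p₀ * (v * v))
                      ≡ (+ 2 * u - p₁ * v) * (+ 2 * u - p₁ * v) + (+ 4 * p₀ - p₁ * p₁) * (v * v)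
    e = solve-∀

  four-p₀-norm : ∀ u v → + 4 * (p₀ * norm (u , v)) ≡ (+ 2 * p₀ * v - p₁ * u) * (+ 2 * p₀ * v - p₁ * u) + δ * (u * u)
  four-p₀-norm u v = e p₀ p₁ u v
    where
    e : ∀ p₀ p₁ u v → + 4 * (p₀ * (u * u - p₁ * u * v + p₀ * (v * v)))
                      ≡ (+ 2 * p₀ * v - p₁ * u) * (+ 2 * p₀ * v - p₁ * u) + (+ 4 * p₀ - p₁ * p₁) * (u * u)
    e = solve-∀

  norm-step : ∀ u v → p₀ * norm (step (u , v)) ≡ norm (u , v) - digit u * (+ 2 * u - p₁ * v) + digit u * digit u
  norm-step u v = subst (λ x → p₀ * norm (step (u , v)) ≡ norm (x , v) - digit u * (+ 2 * x - p₁ * v) + digit u * digit u)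
                        (digit+quot u) (e p₀ p₁ (digit u) (quot u) v)
    where
    e : ∀ p₀ p₁ d q v →
        p₀ * ((v - p₁ * q) * (v - p₁ * q) - p₁ * (v - p₁ * q) * - q + p₀ * (- q * - q))
        ≡ (d + p₀ * q) * (d + p₀ * q) - p₁ * (d + p₀ * q) * v + p₀ * (v * v)
          - d * (+ 2 * (d + p₀ * q) - p₁ * v) + d * d
    e = solve-∀

  box : List ℤ
  box = interval (- + 4) 9

  box-reaches-0 : ℕ → Bool
  box-reaches-0 n = all (λ u → all (λ v → reaches-0 n (u , v)) box) box

  -- Away from the finitely many points of norm < B, which lie in box × box, each step lowers the norm.
  module Termination (B K : ℤ) (n : ℕ) (δ≥4 : + 4 ≤ δ) (p₀≥2 : + 2 ≤ p₀)
                     (-K≤lo : - K ≤ lo) (lo+p₀≤1+K : lo + p₀ ≤ ℤ.suc K)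
                     (B-large : + 6 * (K * K) < (+ 2 * p₀ - + 3) * B) (B-small : p₀ * B ≤ + 25)
                     (0-ok : InWindow 0ℤ) (box-check : T (box-reaches-0 n)) where

    δ-nonNeg : 0ℤ ≤ δ
    δ-nonNeg = ≤-trans (+≤+ ℕ.z≤n) δ≥4

    norm-nonNeg : ∀ w → 0ℤ ≤ norm w
    norm-nonNeg (u , v) = *-cancelˡ-≤-pos 0ℤ (norm (u , v)) (+ 4) (subst (0ℤ ≤_) (sym (four-norm u v))
      (+-mono-≤ (square-nonNeg (+ 2 * u - p₁ * v)) (nonNeg-* δ-nonNeg (square-nonNeg v))))

    square≤ : ∀ {c} s x → + 4 * c ≡ s * s + δ * (x * x) → x * x ≤ c
    square≤ {c} s x eq = *-cancelˡ-≤-pos (x * x) c (+ 4) (begin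
      + 4 * (x * x)         ≤⟨ *-monoʳ-≤-nonNeg (x * x) {{ℤ.nonNegative (square-nonNeg x)}} δ≥4 ⟩
      δ * (x * x)           ≤⟨ i≤j+i (δ * (x * x)) (s * s) {{ℤ.nonNegative (square-nonNeg s)}} ⟩
      s * s + δ * (x * x)   ≡⟨ sym eq ⟩
      + 4 * c               ∎)
      where open ≤-Reasoning

    digit-square : ∀ {d} → InWindow d → d * d ≤ K * K
    digit-square {d} (lo≤d , d<lo+p₀) = 0≤i-j⇒j≤i (subst (0ℤ ≤_) (e K d) (nonNeg-* (i≤j⇒0≤j-i d≤K) (i≤j⇒0≤j-i -K≤d)))
      where
      e : ∀ K d → (K - d) * (d - - K) ≡ K * K - d * d
      e = solve-∀
      -K≤d : - K ≤ d
      -K≤d = ≤-trans -K≤lo lo≤d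
      d≤K : d ≤ K
      d≤K = subst (d ≤_) (pred-suc K) (i<j⇒i≤pred[j] (<-≤-trans d<lo+p₀ lo+p₀≤1+K))

    step-decreases : ∀ w → B ≤ norm w → norm (step w) < norm w
    step-decreases (u , v) B≤N = *-cancelˡ-<-nonNeg p₀ (begin-strict
      p₀ * norm (step (u , v))        ≡⟨ norm-step u v ⟩
      N - d * s + d * d               <⟨ contraction-bound p₀ N s d s²≤4N 6d²<[2p₀-3]N ⟩
      p₀ * N                          ∎)
      where
      open ≤-Reasoning
      N = norm (u , v)
      d = digit u
      s = + 2 * u - p₁ * v
      s²≤4N : s * s ≤ + 4 * N
      s²≤4N = subst (s * s ≤_) (sym (four-norm u v)) (i≤i+j (s * s) _ {{ℤ.nonNegative (nonNeg-* δ-nonNeg (square-nonNeg v))}})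
      6d²<[2p₀-3]N : + 6 * (d * d) < (+ 2 * p₀ - + 3) * N
      6d²<[2p₀-3]N = begin-strict
        + 6 * (d * d)            ≤⟨ *-monoˡ-≤-nonNeg (+ 6) (digit-square (digit-window u)) ⟩
        + 6 * (K * K)            <⟨ B-large ⟩
        (+ 2 * p₀ - + 3) * B     ≤⟨ *-monoˡ-≤-nonNeg (+ 2 * p₀ - + 3) {{ℤ.nonNegative 2p₀-3≥0}} B≤N ⟩
        (+ 2 * p₀ - + 3) * N     ∎
        where
        2p₀-3≥0 : 0ℤ ≤ + 2 * p₀ - + 3
        2p₀-3≥0 = i≤j⇒0≤j-i (≤-trans (i≤suc[i] (+ 3)) (*-monoˡ-≤-nonNeg (+ 2) p₀≥2))

    small-expansion : ∀ w → norm w < B → Expansion w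
    small-expansion (u , v) N<B =
      reaches-0⇒expansion 0-ok n (u , v) (All.lookup (all⁺ (λ v → reaches-0 n (u , v)) box u-row) (∈-box {v} v²<25))
      where
      open ≤-Reasoning
      N = norm (u , v)
      ∈-box : ∀ {x} → x * x < + 25 → x ∈ box
      ∈-box {x} x²<25 = let (-5<x , x<5) = square<⇒bounded {x} {+ 5} (+≤+ ℕ.z≤n) x²<25 in ∈-interval 9 (i<j⇒suc[i]≤j -5<x) x<5
      p₀N<25 : p₀ * N < + 25
      p₀N<25 = <-≤-trans (*-monoˡ-<-pos p₀ N<B) B-small
      u²<25 : u * u < + 25
      u²<25 = ≤-<-trans (square≤ (+ 2 * p₀ * v - p₁ * u) u (four-p₀-norm u v)) p₀N<25
      u-row : T (all (λ v → reaches-0 n (u , v)) box)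
      u-row = All.lookup (all⁺ (λ u → all (λ v → reaches-0 n (u , v)) box) box box-check) (∈-box {u} u²<25)
      v²<25 : v * v < + 25
      v²<25 = begin-strict
        v * v        ≤⟨ square≤ (+ 2 * u - p₁ * v) v (four-norm u v) ⟩
        N            ≡⟨ sym (*-identityˡ N) ⟩
        1ℤ * N       ≤⟨ *-monoʳ-≤-nonNeg N {{ℤ.nonNegative (norm-nonNeg (u , v))}} (≤-trans (+≤+ (ℕ.s≤s ℕ.z≤n)) p₀≥2) ⟩
        p₀ * N       <⟨ p₀N<25 ⟩
        + 25         ∎

    expansions : ∀ w → Expansion w
    expansions w = go w (<-wellFounded ∣ norm w ∣)
      where
      ∣∣-mono-< : ∀ {i j} → 0ℤ ≤ i → i < j → ∣ i ∣ ℕ.< ∣ j ∣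
      ∣∣-mono-< (+≤+ _) (+<+ m<n) = m<n
      go : ∀ w → Acc ℕ._<_ ∣ norm w ∣ → Expansion w
      go w (acc rec) with B ≤? norm w
      ... | yes B≤N = expansion-step w (go (step w) (rec (∣∣-mono-< (norm-nonNeg (step w)) (step-decreases w B≤N))))
      ... | no  B≰N = small-expansion w (≰⇒> B≰N)

  module _ {ε : ℚ} (digits : ∀ d → InDigits ε p₀ d ⇔ InWindow d) where

    IsεCNS⇔expansions : IsεCNS ε P ⇔ (∀ w → Expansion w)
    IsεCNS⇔expansions = mk⇔ to from
      where
      to : IsεCNS ε P → ∀ w → Expansion w
      to cns w = let (ds , nonempty , ds-ok , w≡ds) = cns (toPoly w) in
        ds , nonempty , All.map (Equivalence.to (digits _)) ds-ok ,
        trans (sym (Equivalence.to (≡[mod]⇔residue≡ {toPoly w}) w≡ds)) (residue-toPoly w)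
      from : (∀ w → Expansion w) → IsεCNS ε P
      from expansions a = let (ds , nonempty , ds-ok , ds↦a) = expansions (residue a) in
        ds , nonempty , All.map (Equivalence.from (digits _)) ds-ok , Equivalence.from ≡[mod]⇔residue≡ (sym ds↦a)

-- Rounding rationals

↥-toℚ : ∀ i → ℚ.↥ (toℚ i) ≡ i
↥-toℚ i = trans (sym (*-identityʳ _)) (trans (cong (λ g → ℚ.↥ (toℚ i) * + g) (sym (gcd-zeroʳ ∣ i ∣))) (↥-/ i 1))

↧-toℚ : ∀ i → ℚ.↧ (toℚ i) ≡ 1ℤ
↧-toℚ i = trans (sym (*-identityʳ _)) (trans (cong (λ g → ℚ.↧ (toℚ i) * + g) (sym (gcd-zeroʳ ∣ i ∣))) (↧-/ i 1))

↥-toℚ-*-↧ : ∀ i x → ℚ.↥ (toℚ i) * ℚ.↧ x ≡ i * ℚ.↧ x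
↥-toℚ-*-↧ i x = cong (_* ℚ.↧ x) (↥-toℚ i)

↥-*-↧-toℚ : ∀ x i → ℚ.↥ x * ℚ.↧ (toℚ i) ≡ ℚ.↥ x
↥-*-↧-toℚ x i = trans (cong (ℚ.↥ x *_) (↧-toℚ i)) (*-identityʳ (ℚ.↥ x))

↥-toℚ-*-↧-toℚ : ∀ i j → ℚ.↥ (toℚ i) * ℚ.↧ (toℚ j) ≡ i
↥-toℚ-*-↧-toℚ i j = trans (↥-*-↧-toℚ (toℚ i) j) (↥-toℚ i)

toℚ-mono-≤ : ∀ {i j} → i ≤ j → toℚ i ℚ.≤ toℚ j
toℚ-mono-≤ {i} {j} i≤j = ℚ.*≤* (subst₂ _≤_ (sym (↥-toℚ-*-↧-toℚ i j)) (sym (↥-toℚ-*-↧-toℚ j i)) i≤j)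

toℚ-cancel-< : ∀ {i j} → toℚ i ℚ.< toℚ j → i < j
toℚ-cancel-< {i} {j} (ℚ.*<* h) = subst₂ _<_ (↥-toℚ-*-↧-toℚ i j) (↥-toℚ-*-↧-toℚ j i) h

floor-unique : ∀ {x k} → toℚ k ℚ.≤ x → x ℚ.< toℚ (ℤ.suc k) → floor x ≡ k
floor-unique {x@(ℚ.mkℚ a d-1 _)} {k} (ℚ.*≤* k≤x) (ℚ.*<* x<1+k) = sym (quotient-unique
  (i≤j⇒0≤j-i kD≤a′) a-kD<D (+≤+ ℕ.z≤n) (+<+ (n%d<d a D)) (begin
    a - k * D + k * D           ≡⟨ e a (k * D) ⟩
    a                           ≡⟨ a≡a%n+[a/n]*n a D ⟩
    + (a ℤ.% D) + (a ℤ./ D) * D ∎))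
  where
  open ≡-Reasoning
  D = + suc d-1
  kD≤a′ : k * D ≤ a
  kD≤a′ = subst₂ _≤_ (↥-toℚ-*-↧ k x) (↥-*-↧-toℚ x k) k≤x
  a<[1+k]D : a < ℤ.suc k * D
  a<[1+k]D = subst₂ _<_ (↥-*-↧-toℚ x (ℤ.suc k)) (↥-toℚ-*-↧ (ℤ.suc k) x) x<1+k
  e : ∀ a b → a - b + b ≡ a
  e = solve-∀
  e′ : ∀ a b → a + b - b ≡ a
  e′ = solve-∀
  a-kD<D : a - k * D < D
  a-kD<D = subst (a - k * D <_) (e′ D (k * D)) (+-monoˡ-< (- (k * D)) (subst (a <_) (suc-* k D) a<[1+k]D))

module _ {y : ℚ} {m : ℤ} (pred-m<y : toℚ (ℤ.pred m) ℚ.< y) (y≤m : y ℚ.≤ toℚ m) where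

  ≤-toℚ⇔ : ∀ d → y ℚ.≤ toℚ d ⇔ m ≤ d
  ≤-toℚ⇔ d = mk⇔ (λ y≤d → subst (_≤ d) (suc-pred m) (i<j⇒suc[i]≤j (toℚ-cancel-< {ℤ.pred m} (ℚP.<-≤-trans pred-m<y y≤d))))
                 (λ m≤d → ℚP.≤-trans y≤m (toℚ-mono-≤ m≤d))

  toℚ-<⇔ : ∀ d → toℚ d ℚ.< y ⇔ d < m
  toℚ-<⇔ d = mk⇔ (λ d<y → toℚ-cancel-< (ℚP.<-≤-trans d<y y≤m))
                 (λ d<m → ℚP.≤-<-trans (toℚ-mono-≤ (i<j⇒i≤pred[j] d<m)) pred-m<y)

InDigits⇔ : ∀ {ε p₀ lo hi} → let c = toℚ (+ ∣ p₀ ∣) in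
            toℚ (ℤ.pred lo) ℚ.< ℚ.- (ε ℚ.* c) → ℚ.- (ε ℚ.* c) ℚ.≤ toℚ lo →
            toℚ (ℤ.pred hi) ℚ.< (ℚ.1ℚ ℚ.- ε) ℚ.* c → (ℚ.1ℚ ℚ.- ε) ℚ.* c ℚ.≤ toℚ hi →
            ∀ d → InDigits ε p₀ d ⇔ (lo ≤ d × d < hi)
InDigits⇔ lo₁ lo₂ hi₁ hi₂ d = ≤-toℚ⇔ lo₁ lo₂ d ×-⇔ toℚ-<⇔ hi₁ hi₂ d

module ScaledBounds {a b ε : ℚ} (a≤ε : a ℚ.≤ ε) (ε<b : ε ℚ.< b) (c : ℚ) .{{_ : ℚ.Positive c}} where

  private instance
    c≥0 : ℚ.NonNegative c
    c≥0 = ℚP.pos⇒nonNeg c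

  scaled : a ℚ.* c ℚ.≤ ε ℚ.* c × ε ℚ.* c ℚ.< b ℚ.* c
  scaled = ℚP.*-monoʳ-≤-nonNeg c a≤ε , ℚP.*-monoˡ-<-pos c ε<b

  negated : ℚ.- (b ℚ.* c) ℚ.< ℚ.- (ε ℚ.* c) × ℚ.- (ε ℚ.* c) ℚ.≤ ℚ.- (a ℚ.* c)
  negated = ℚP.neg-antimono-< (proj₂ scaled) , ℚP.neg-antimono-≤ (proj₁ scaled)

  complement : (ℚ.1ℚ ℚ.- b) ℚ.* c ℚ.< (ℚ.1ℚ ℚ.- ε) ℚ.* c × (ℚ.1ℚ ℚ.- ε) ℚ.* c ℚ.≤ (ℚ.1ℚ ℚ.- a) ℚ.* c
  complement = ℚP.*-monoˡ-<-pos c (ℚP.+-monoʳ-< ℚ.1ℚ (ℚP.neg-antimono-< ε<b))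
             , ℚP.*-monoʳ-≤-nonNeg c (ℚP.+-monoʳ-≤ ℚ.1ℚ (ℚP.neg-antimono-≤ a≤ε))

-- The cases p₀ = 2 and p₀ = 4

module Radix2 (p₁ : ℤ) = Dynamics (+ 2) p₁ -1ℤ

expansions-radix-2 : ∀ p₁ {δ≥4 : True (+ 4 ≤? Radix2.δ p₁)} {check : T (Radix2.box-reaches-0 p₁ 15)} →
                     ∀ w → Radix2.Expansion p₁ w
expansions-radix-2 p₁ {δ≥4} {check} = Termination.expansions (+ 7) 1ℤ 15 (toWitness δ≥4) ≤-refl ≤-refl
  (from-yes (1ℤ ≤? + 2)) (from-yes (+ 6 <? + 7)) (from-yes (+ 14 ≤? + 25)) (from-yes (-1ℤ ≤? 0ℤ) , from-yes (0ℤ <? 1ℤ)) check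
  where open Radix2 p₁

sufficient-radix-2 : ∀ {p₁} → -1ℤ ≤ p₁ × p₁ ≤ + 2 → ∀ w → Radix2.Expansion p₁ w
sufficient-radix-2 {p₁} (-1≤p₁ , p₁≤2) = All.lookup {P = λ p₁ → ∀ w → Radix2.Expansion p₁ w}
  (expansions-radix-2 -1ℤ ∷ expansions-radix-2 0ℤ ∷ expansions-radix-2 1ℤ ∷ expansions-radix-2 (+ 2) ∷ [])
  (∈-interval 4 -1≤p₁ (i≤pred[j]⇒i<j p₁≤2))

necessary-radix-2 : ∀ p₁ → (∀ w → Radix2.Expansion p₁ w) → -1ℤ ≤ p₁ × p₁ ≤ + 2
necessary-radix-2 p₁ expansions = ≮⇒≥ not-below , ≮⇒≥ not-above
  where
  open Radix2 p₁
  not-above : ¬ + 2 < p₁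
  not-above 2<p₁ = invariant-no-expansion (opposite-cones-invariant 3≤p₁ ≤-refl -≤+) (opposite-cones-0 3≤p₁ ≤-refl -≤+)
                     (inj₁ (≤-refl , ≤-refl)) (expansions (+ 2 , 1ℤ))
    where 3≤p₁ = i<j⇒suc[i]≤j 2<p₁
  not-below : ¬ p₁ < -1ℤ
  not-below p₁<-1 with p₁ ℤ.≟ - + 2
  ... | yes refl  = 2-cycle-no-expansion refl refl (λ ()) (λ ()) (expansions (1ℤ , -1ℤ))
  ... | no p₁≢-2 = invariant-no-expansion (lower-cone-invariant p₁≤-3 -≤+) (lower-cone-0 p₁≤-3 -≤+)
                     (≤-refl , ≤-refl) (expansions (+ 2 , -1ℤ))
    where p₁≤-3 = i<j⇒i≤pred[j] (≤∧≢⇒< (i<j⇒i≤pred[j] p₁<-1) p₁≢-2)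

module _ {ε : ℚ} (½≤ε : ½ ℚ.≤ ε) (ε<1 : ε ℚ.< ½ ℚ.+ recipℕ 2) where
  open ScaledBounds ½≤ε ε<1 (toℚ (+ 2))

  floor-radix-2 : floor (ε ℚ.* toℚ (+ 2)) ≡ 1ℤ
  floor-radix-2 = floor-unique (proj₁ scaled) (proj₂ scaled)

  IsεCNS⇔-radix-2 : ∀ p₁ → IsεCNS ε (+ 2 ∷ p₁ ∷ + 1 ∷ []) ⇔ (-1ℤ ≤ p₁ × p₁ ≤ + 2)
  IsεCNS⇔-radix-2 p₁ = mk⇔ (necessary-radix-2 p₁) sufficient-radix-2 ⇔-∘ Radix2.IsεCNS⇔expansions p₁ {ε}
    (InDigits⇔ {ε} {+ 2} (proj₁ negated) (proj₂ negated) (proj₁ complement) (proj₂ complement))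

module Radix4 (p₁ : ℤ) = Dynamics (+ 4) p₁ (- + 2)

expansions-radix-4 : ∀ p₁ {δ≥4 : True (+ 4 ≤? Radix4.δ p₁)} {check : T (Radix4.box-reaches-0 p₁ 15)} →
                     ∀ w → Radix4.Expansion p₁ w
expansions-radix-4 p₁ {δ≥4} {check} = Termination.expansions (+ 5) (+ 2) 15 (toWitness δ≥4) (from-yes (+ 2 ≤? + 4)) ≤-refl
  (from-yes (+ 2 ≤? + 3)) (from-yes (+ 24 <? + 25)) (from-yes (+ 20 ≤? + 25)) (from-yes (- + 2 ≤? 0ℤ) , from-yes (0ℤ <? + 2)) check
  where open Radix4 p₁

sufficient-radix-4 : ∀ {p₁} → - + 2 ≤ p₁ × p₁ ≤ + 3 → ∀ w → Radix4.Expansion p₁ w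
sufficient-radix-4 {p₁} (-2≤p₁ , p₁≤3) = All.lookup {P = λ p₁ → ∀ w → Radix4.Expansion p₁ w}
  (expansions-radix-4 (- + 2) ∷ expansions-radix-4 -1ℤ ∷ expansions-radix-4 0ℤ ∷
   expansions-radix-4 1ℤ ∷ expansions-radix-4 (+ 2) ∷ expansions-radix-4 (+ 3) ∷ [])
  (∈-interval 6 -2≤p₁ (i≤pred[j]⇒i<j p₁≤3))

necessary-radix-4 : ∀ p₁ → (∀ w → Radix4.Expansion p₁ w) → - + 2 ≤ p₁ × p₁ ≤ + 3
necessary-radix-4 p₁ expansions = ≮⇒≥ not-below , ≮⇒≥ not-above
  where
  open Radix4 p₁
  not-above : ¬ + 3 < p₁
  not-above 3<p₁ with p₁ ℤ.≟ + 4
  ... | yes refl = 2-cycle-no-expansion refl refl (λ ()) (λ ()) (expansions (+ 3 , 1ℤ))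
  ... | no p₁≢4  = invariant-no-expansion (opposite-cones-invariant 5≤p₁ (from-yes (- + 3 ≤? - + 2)) -≤+)
                     (opposite-cones-0 5≤p₁ (from-yes (- + 3 ≤? - + 2)) -≤+) (inj₁ (≤-refl , ≤-refl)) (expansions (+ 4 , 1ℤ))
    where 5≤p₁ = i<j⇒suc[i]≤j (≤∧≢⇒< (i<j⇒suc[i]≤j 3<p₁) (p₁≢4 ∘ sym))
  not-below : ¬ p₁ < - + 2
  not-below p₁<-2 with p₁ ℤ.≟ - + 3 | p₁ ℤ.≟ - + 4
  ... | yes refl | _        = 2-cycle-no-expansion refl refl (λ ()) (λ ()) (expansions (+ 2 , -1ℤ))
  ... | no _     | yes refl = 2-cycle-no-expansion refl refl (λ ()) (λ ()) (expansions (+ 3 , -1ℤ))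
  ... | no p₁≢-3 | no p₁≢-4 = invariant-no-expansion (lower-cone-invariant p₁≤-5 -≤+) (lower-cone-0 p₁≤-5 -≤+)
                                (≤-refl , ≤-refl) (expansions (+ 4 , -1ℤ))
    where p₁≤-5 = i<j⇒i≤pred[j] (≤∧≢⇒< (i<j⇒i≤pred[j] (≤∧≢⇒< (i<j⇒i≤pred[j] p₁<-2) p₁≢-3)) p₁≢-4)

module _ {ε : ℚ} (½≤ε : ½ ℚ.≤ ε) (ε<¾ : ε ℚ.< ½ ℚ.+ recipℕ 4) where
  open ScaledBounds ½≤ε ε<¾ (toℚ (+ 4))

  floor-radix-4 : floor (ε ℚ.* toℚ (+ 4)) ≡ + 2
  floor-radix-4 = floor-unique (proj₁ scaled) (proj₂ scaled)

  IsεCNS⇔-radix-4 : ∀ p₁ → IsεCNS ε (+ 4 ∷ p₁ ∷ + 1 ∷ []) ⇔ (- + 2 ≤ p₁ × p₁ ≤ + 3)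
  IsεCNS⇔-radix-4 p₁ = mk⇔ (necessary-radix-4 p₁) sufficient-radix-4 ⇔-∘ Radix4.IsεCNS⇔expansions p₁ {ε}
    (InDigits⇔ {ε} {+ 4} (proj₁ negated) (proj₂ negated) (proj₁ complement) (proj₂ complement))

lemma4p6 : (p₀ : ℤ) → (p₀ ≡ + 2 ⊎ p₀ ≡ + 4) → (ε : ℚ) → ½ ℚ.≤ ε → ε ℚ.< ½ ℚ.+ recipℕ ∣ p₀ ∣ →
  (p₁ : ℤ) →
  IsεCNS ε (p₀ ∷ p₁ ∷ + 1 ∷ []) ⇔
    ((- p₀ ℤ.+ floor (ε ℚ.* toℚ (+ ∣ p₀ ∣)) ℤ.≤ p₁) × (p₁ ℤ.≤ floor (ε ℚ.* toℚ (+ ∣ p₀ ∣)) ℤ.+ + 1))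
lemma4p6 _ (inj₁ refl) ε ½≤ε ε<1 p₁ rewrite floor-radix-2 ½≤ε ε<1 = IsεCNS⇔-radix-2 ½≤ε ε<1 p₁
lemma4p6 _ (inj₂ refl) ε ½≤ε ε<¾ p₁ rewrite floor-radix-4 ½≤ε ε<¾ = IsεCNS⇔-radix-4 ½≤ε ε<¾ p₁
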